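{- Let $\mathbf{x}$ be a uniformly recurrent sequence. Then either (a) $\mathbf{x}$ is reversal-closed, so that $\rho_{\mathbf{x}} = \mathrm{Refl}_{\mathbf{x}}$ and $r_{\mathbf{x}} = \frac{1}{2}(\rho_{\mathbf{x}} + \mathrm{Pal}_{\mathbf{x}})$; or else (b) there exists $n_0$ such that $\rho_{\mathbf{x}}(n) = \mathrm{Unr}_{\mathbf{x}}(n)$ for all $n \geq n_0$ (so $\mathbf{x}$ has no reflected factor, and in particular no palindrome, of length $\ge n_0$), and consequently $r_{\mathbf{x}}(n) = \rho_{\mathbf{x}}(n)$ for all $n \geq n_0$.
   Context: A factor of a sequence is a finite contiguous block. $\mathbf{x}$ is uniformly recurrent if every factor $w$ occurs in every block of length $m(w)$ for some $m(w)$. For $u=u(1)\cdots u(m)$, $u^R=u(m)\cdots u(1)$; a palindrome satisfies $u=u^R$. $\rho_{\mathbf{x}}(n)$ is the number of distinct length-$n$ factors; $r_{\mathbf{x}}(n)$ the number of distinct length-$n$ factors up to $u\sim v\iff v\in\{u,u^R\}$; $\mathrm{Pal}_{\mathbf{x}}(n)$ the number of length-$n$ palindromic factors; $\mathrm{Refl}_{\mathbf{x}}(n)$ the number of length-$n$ factors $w$ with $w^R$ also a factor; $\mathrm{Unr}_{\mathbf{x}}(n)$ the number of length-$n$ factors $w$ with $w^R$ not a factor. $\mathbf{x}$ is reversal-closed if $w^R$ is a factor for every factor $w$. -}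

module Defs where

open import Level using (0ℓ)
open import Data.Nat using (ℕ; zero; suc; _+_; _≤_)
open import Data.Fin using (Fin; toℕ)
open import Data.Fin.Properties using (_<?_)
open import Data.Bool using (Bool; true; false; if_then_else_)
open import Data.List using (List; []; _∷_; concatMap; map; filter; length; allFin)
open import Data.Vec using (Vec; []; _∷_; tabulate; reverse)
open import Data.Product using (Σ; ∃; _×_; _,_)
open import Relation.Binary.PropositionalEquality using (_≡_)
open import Relation.Nullary using (¬_; Dec; yes; no; does)
open import Axiom.ExcludedMiddle using (ExcludedMiddle)

Seq : ℕ → Set
Seq k = ℕ → Fin k

Word : ℕ → ℕ → Set
Word k n = Vec (Fin k) n

block : ∀ {k} → Seq k → ℕ → (n : ℕ) → Word k n
block x i n = tabulate (λ j → x (i + toℕ j))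

Factor : ∀ {k n} → Seq k → Word k n → Set
Factor {n = n} x w = ∃ λ (i : ℕ) → block x i n ≡ w

OccursIn : ∀ {k n} → Seq k → Word k n → ℕ → ℕ → Set
OccursIn {n = n} x w i m = ∃ λ j → i ≤ j × (j + n ≤ i + m) × block x j n ≡ w

UniformlyRecurrent : ∀ {k} → Seq k → Set
UniformlyRecurrent x =
  ∀ {n} (w : Word _ n) → Factor x w → ∃ λ m → ∀ i → OccursIn x w i m

Palindrome : ∀ {k n} → Word k n → Set
Palindrome w = reverse w ≡ w

ReversalClosed : ∀ {k} → Seq k → Set
ReversalClosed x = ∀ {n} (w : Word _ n) → Factor x w → Factor x (reverse w)

allWords : (k n : ℕ) → List (Word k n)
allWords k zero = [] ∷ []
allWords k (suc n) = concatMap (λ a → map (a ∷_) (allWords k n)) (allFin k)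

count : ExcludedMiddle 0ℓ → ∀ {k} → (n : ℕ) → (Word k n → Set) → ℕ
count em {k} n P = length (filter (λ w → em {P w}) (allWords k n))

lexLeq : ∀ {k n} → Word k n → Word k n → Bool
lexLeq [] [] = true
lexLeq (a ∷ u) (b ∷ v) with does (a <? b) | does (b <? a)
... | true  | _     = true
... | false | true  = false
... | false | false = lexLeq u v

canon : ∀ {k n} → Word k n → Word k n
canon w = if lexLeq w (reverse w) then w else reverse w

module _ (em : ExcludedMiddle 0ℓ) {k : ℕ} (x : Seq k) where

  ρ : ℕ → ℕ
  ρ n = count em n (λ w → Factor x w)

  -- r_x(n): number of classes of length-n factors under u ~ v iff v ∈ {u, u^R};
  -- each class {u, u^R} is counted via its canonical representative canon u
  r : ℕ → ℕ
  r n = count em n (λ v → ∃ λ (w : Word k n) → Factor x w × canon w ≡ v)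

  Pal : ℕ → ℕ
  Pal n = count em n (λ w → Factor x w × Palindrome w)

  Refl : ℕ → ℕ
  Refl n = count em n (λ w → Factor x w × Factor x (reverse w))

  Unr : ℕ → ℕ
  Unr n = count em n (λ w → Factor x w × ¬ Factor x (reverse w))

{-# OPTIONS --safe #-}
-- If some factor w has a reversal that is not a factor, uniform recurrence puts w inside every
-- factor u of length at least m; reversing, the reversal of w sits inside the reversal of u, so the
-- reversal of u is not a factor either. Hence either every factor is reflected, or no factor of
-- length ≥ m is. In the first case r counts the factors w with w ≼ wᴿ (lexicographically);
-- reversal matches them with the factors satisfying wᴿ ≼ w, the two families cover all factors
-- and overlap exactly in the palindromes, so 2r = ρ + Pal by inclusion–exclusion. In the second
-- case canon is injective on the factors of length ≥ m, so r = ρ.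
module Submission where

open import Defs
open import Level using (0ℓ)
open import Axiom.ExcludedMiddle using (ExcludedMiddle)
open import Data.Bool using (true; false)
open import Data.Fin using (toℕ)
open import Data.Fin.Properties using (toℕ-injective)
open import Data.List using ([]; _∷_; _++_; map; filter; length; concatMap; allFin; cartesianProductWith)
open import Data.List.Properties using (length-map; filter-accept; filter-reject)
open import Data.List.Membership.Propositional using (_∈_)
open import Data.List.Membership.Propositional.Properties
  using (∈-map⁺; ∈-map⁻; ∈-filter⁺; ∈-filter⁻; ∈-allFin; ∈-cartesianProductWith⁺)
open import Data.List.Membership.Propositional.Properties.WithK using (unique∧set⇒bag)
open import Data.List.Relation.Binary.BagAndSetEquality using (∼bag⇒↭)
open import Data.List.Relation.Binary.Permutation.Propositional.Properties using (↭-length)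
open import Data.List.Relation.Unary.All using (All; []; _∷_)
import Data.List.Relation.Unary.All as All
import Data.List.Relation.Unary.All.Properties as All
open import Data.List.Relation.Unary.Any using (here)
open import Data.List.Relation.Unary.Unique.Propositional using (Unique; []; _∷_)
open import Data.List.Relation.Unary.Unique.Propositional.Properties
  using (filter⁺; allFin⁺; cartesianProductWith⁺)
open import Data.Nat using (ℕ; zero; suc; _+_; _*_; _≤_; _≥_; _<ᵇ_)
open import Data.Nat.Properties
  using ( +-suc; +-identityʳ; +-comm; +-assoc; +-cancelˡ-≡; +-monoʳ-≤; ≤-trans; ≤-antisym
        ; m≤n⇒∃[o]m+o≡n; <ᵇ-reflects-<; <-irrefl; <-asym; ≮⇒≥)
open import Data.Product using (∃; ∃₂; _×_; _,_; proj₁; proj₂)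
open import Data.Sum using (_⊎_; inj₁; inj₂; [_,_])
import Data.Sum as Sum
open import Data.Vec using ([]; _∷_; _∷ʳ_; reverse)
open import Data.Vec.Properties
  using ( ∷-injective; ∷ʳ-injectiveˡ; tabulate-cong
        ; reverse-∷; reverse-involutive; reverse-reverse; reverse-injective)
open import Function using (id; _∘_; _⇔_; mk⇔)
open import Relation.Binary.PropositionalEquality
  using (_≡_; refl; sym; trans; cong; cong₂; subst; module ≡-Reasoning)
open import Relation.Nullary using (¬_; yes; no; contradiction)
open import Relation.Nullary.Reflects using (ofʸ; ofⁿ)
open import Relation.Unary using (Pred; Decidable; _∪_; _∩_; _≐_)

unique-map-on : ∀ {A B : Set} {P : Pred A 0ℓ} {f : A → B} {xs} →
  (∀ {a a′} → P a → P a′ → f a ≡ f a′ → a ≡ a′) → All P xs → Unique xs → Unique (map f xs)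
unique-map-on inj [] [] = []
unique-map-on inj (pa ∷ pas) (a∉ ∷ xs-unique) =
  All.map⁺ (All.zipWith (λ (pa′ , a≢a′) → a≢a′ ∘ inj pa pa′) (pas , a∉))
  ∷ unique-map-on inj pas xs-unique

module _ {A B : Set} {P : Pred A 0ℓ} {Q : Pred B 0ℓ} (P? : Decidable P) (Q? : Decidable Q) where

  length-filter-bij : ∀ {xs ys} → Unique xs → Unique ys → (∀ a → a ∈ xs) → (∀ b → b ∈ ys) →
    (f : A → B) → (∀ {a} → P a → Q (f a)) → (∀ {a a′} → P a → P a′ → f a ≡ f a′ → a ≡ a′) →
    (∀ {b} → Q b → ∃ λ a → P a × f a ≡ b) →
    length (filter P? xs) ≡ length (filter Q? ys)
  length-filter-bij {xs} {ys} xs-unique ys-unique xs-complete ys-complete f f-maps f-inj f-onto =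
    begin
      length (filter P? xs)          ≡⟨ length-map f (filter P? xs) ⟨
      length (map f (filter P? xs))  ≡⟨ ↭-length (∼bag⇒↭ (unique∧set⇒bag image-unique
                                          (filter⁺ Q? ys-unique) same-members)) ⟩
      length (filter Q? ys)          ∎
    where
    open ≡-Reasoning
    image-unique : Unique (map f (filter P? xs))
    image-unique = unique-map-on f-inj (All.all-filter P? xs) (filter⁺ P? xs-unique)
    image⊆ : ∀ {b} → b ∈ map f (filter P? xs) → b ∈ filter Q? ys
    image⊆ b∈ with a , a∈ , refl ← ∈-map⁻ f b∈ =
      ∈-filter⁺ Q? (ys-complete _) (f-maps (proj₂ (∈-filter⁻ P? {xs = xs} a∈)))
    image⊇ : ∀ {b} → b ∈ filter Q? ys → b ∈ map f (filter P? xs)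
    image⊇ b∈ with a , pa , refl ← f-onto (proj₂ (∈-filter⁻ Q? {xs = ys} b∈)) =
      ∈-map⁺ f (∈-filter⁺ P? (xs-complete a) pa)
    same-members : ∀ {b} → b ∈ map f (filter P? xs) ⇔ b ∈ filter Q? ys
    same-members = mk⇔ image⊆ image⊇

module _ {A : Set} {P Q : Pred A 0ℓ} (P? : Decidable P) (Q? : Decidable Q)
         (P∪Q? : Decidable (P ∪ Q)) (P∩Q? : Decidable (P ∩ Q)) where

  length-filter-∪-∩ : ∀ xs →
    length (filter P? xs) + length (filter Q? xs)
      ≡ length (filter P∪Q? xs) + length (filter P∩Q? xs)
  length-filter-∪-∩ [] = refl
  length-filter-∪-∩ (a ∷ xs) with ih ← length-filter-∪-∩ xs | P? a | Q? a
  ... | yes p | yes q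
    rewrite filter-accept P∪Q? {xs = xs} (inj₁ p) | filter-accept P∩Q? {xs = xs} (p , q)
    = cong suc (trans (+-suc _ _) (trans (cong suc ih) (sym (+-suc _ _))))
  ... | yes p | no ¬q
    rewrite filter-accept P∪Q? {xs = xs} (inj₁ p) | filter-reject P∩Q? {xs = xs} (¬q ∘ proj₂)
    = cong suc ih
  ... | no ¬p | yes q
    rewrite filter-accept P∪Q? {xs = xs} (inj₂ q) | filter-reject P∩Q? {xs = xs} (¬p ∘ proj₁)
    = trans (+-suc _ _) (cong suc ih)
  ... | no ¬p | no ¬q
    rewrite filter-reject P∪Q? {xs = xs} [ ¬p , ¬q ] | filter-reject P∩Q? {xs = xs} (¬p ∘ proj₁)
    = ih

concatMap-map≡cartesianProductWith : ∀ {A B C : Set} (f : A → B → C) xs ys →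
  concatMap (λ a → map (f a) ys) xs ≡ cartesianProductWith f xs ys
concatMap-map≡cartesianProductWith f []       ys = refl
concatMap-map≡cartesianProductWith f (a ∷ xs) ys =
  cong (map (f a) ys ++_) (concatMap-map≡cartesianProductWith f xs ys)

module _ {k : ℕ} where

  allWords-unique : ∀ n → Unique (allWords k n)
  allWords-unique zero    = [] ∷ []
  allWords-unique (suc n)
    rewrite concatMap-map≡cartesianProductWith {C = Word k (suc n)} _∷_ (allFin k) (allWords k n) =
    cartesianProductWith⁺ _∷_ ∷-injective (allFin⁺ k) (allWords-unique n)

  ∈-allWords : ∀ {n} (w : Word k n) → w ∈ allWords k n
  ∈-allWords []      = here refl
  ∈-allWords {suc n} (a ∷ w)
    rewrite concatMap-map≡cartesianProductWith {C = Word k (suc n)} _∷_ (allFin k) (allWords k n) =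
    ∈-cartesianProductWith⁺ _∷_ (∈-allFin a) (∈-allWords w)

module _ (em : ExcludedMiddle 0ℓ) where

  count-bij : ∀ {k k′} n n′ {P : Pred (Word k n) 0ℓ} {Q : Pred (Word k′ n′) 0ℓ}
    (f : Word k n → Word k′ n′) → (∀ {u} → P u → Q (f u)) →
    (∀ {u v} → P u → P v → f u ≡ f v → u ≡ v) → (∀ {v} → Q v → ∃ λ u → P u × f u ≡ v) →
    count em n P ≡ count em n′ Q
  count-bij _ _ = length-filter-bij (λ _ → em) (λ _ → em)
    (allWords-unique _) (allWords-unique _) ∈-allWords ∈-allWords

  count-cong : ∀ {k} n {P Q : Pred (Word k n) 0ℓ} → P ≐ Q → count em n P ≡ count em n Q
  count-cong n (P⊆Q , Q⊆P) = count-bij n n id P⊆Q (λ _ _ → id) (λ q → _ , Q⊆P q , refl)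

  count-∪-∩ : ∀ {k n} (P Q : Pred (Word k n) 0ℓ) →
    count em n P + count em n Q ≡ count em n (P ∪ Q) + count em n (P ∩ Q)
  count-∪-∩ {k} {n} P Q = length-filter-∪-∩ (λ _ → em) (λ _ → em) (λ _ → em) (λ _ → em) (allWords k n)

_≼_ : ∀ {k n} → Word k n → Word k n → Set
u ≼ v = lexLeq u v ≡ true

module _ {k : ℕ} where

  ≼-refl : ∀ {n} (u : Word k n) → u ≼ u
  ≼-refl []      = refl
  ≼-refl (a ∷ u) with toℕ a <ᵇ toℕ a | <ᵇ-reflects-< (toℕ a) (toℕ a)
  ... | true  | ofʸ a<a = contradiction a<a (<-irrefl refl)
  ... | false | _       = ≼-refl u

  ≼-total : ∀ {n} (u v : Word k n) → u ≼ v ⊎ v ≼ u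
  ≼-total []      []      = inj₁ refl
  ≼-total (a ∷ u) (b ∷ v) with toℕ a <ᵇ toℕ b | toℕ b <ᵇ toℕ a
  ... | true  | _     = inj₁ refl
  ... | false | true  = inj₂ refl
  ... | false | false = ≼-total u v

  ≼-antisym : ∀ {n} (u v : Word k n) → u ≼ v → v ≼ u → u ≡ v
  ≼-antisym []      []      _   _   = refl
  ≼-antisym (a ∷ u) (b ∷ v) u≼v v≼u
    with toℕ a <ᵇ toℕ b | <ᵇ-reflects-< (toℕ a) (toℕ b)
       | toℕ b <ᵇ toℕ a | <ᵇ-reflects-< (toℕ b) (toℕ a)
  ... | true  | ofʸ a<b | true  | ofʸ b<a = contradiction b<a (<-asym a<b)
  ... | false | ofⁿ a≮b | false | ofⁿ b≮a =
    cong₂ _∷_ (toℕ-injective (≤-antisym (≮⇒≥ b≮a) (≮⇒≥ a≮b))) (≼-antisym u v u≼v v≼u)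

  canon-cases : ∀ {n} (w : Word k n) → canon w ≡ w ⊎ canon w ≡ reverse w
  canon-cases w with lexLeq w (reverse w)
  ... | true  = inj₁ refl
  ... | false = inj₂ refl

  canon-fixed : ∀ {n} (w : Word k n) → w ≼ reverse w → canon w ≡ w
  canon-fixed w w≼wᴿ rewrite w≼wᴿ = refl

  canon-≼ : ∀ {n} (w : Word k n) → canon w ≼ reverse (canon w)
  canon-≼ w with lexLeq w (reverse w) in w≼wᴿ | ≼-total w (reverse w)
  ... | true  | _         = w≼wᴿ
  ... | false | inj₂ wᴿ≼w = subst (reverse w ≼_) (sym (reverse-involutive w)) wᴿ≼w

module _ {k : ℕ} (x : Seq k) where

  block-suc : ∀ i n → block x i (suc n) ≡ x i ∷ block x (suc i) n
  block-suc i n = cong₂ _∷_ (cong x (+-identityʳ i)) (tabulate-cong (λ j → cong x (+-suc i (toℕ j))))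

  block-∷ʳ : ∀ i n → block x i (suc n) ≡ block x i n ∷ʳ x (i + n)
  block-∷ʳ i zero    = refl
  block-∷ʳ i (suc n) = begin
    block x i (suc (suc n))                     ≡⟨ block-suc i (suc n) ⟩
    x i ∷ block x (suc i) (suc n)               ≡⟨ cong (x i ∷_) (block-∷ʳ (suc i) n) ⟩
    x i ∷ (block x (suc i) n ∷ʳ x (suc i + n))  ≡⟨ cong (λ j → x i ∷ (block x (suc i) n ∷ʳ x j)) (+-suc i n) ⟨
    (x i ∷ block x (suc i) n) ∷ʳ x (i + suc n)  ≡⟨ cong (_∷ʳ x (i + suc n)) (block-suc i n) ⟨
    block x i (suc n) ∷ʳ x (i + suc n)          ∎
    where open ≡-Reasoning

  Mirrored : ℕ → ℕ → ℕ → Set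
  Mirrored p i n = block x p n ≡ reverse (block x i n)

  mirrored-sym : ∀ {p i n} → Mirrored p i n → Mirrored i p n
  mirrored-sym = sym ∘ reverse-reverse ∘ sym

  mirrored-dropʳ : ∀ {p i} n → Mirrored p i (suc n) → Mirrored p (suc i) n
  mirrored-dropʳ {p} {i} n mirrored = ∷ʳ-injectiveˡ _ _ (begin
    block x p n ∷ʳ x (p + n)            ≡⟨ block-∷ʳ p n ⟨
    block x p (suc n)                   ≡⟨ mirrored ⟩
    reverse (block x i (suc n))         ≡⟨ cong reverse (block-suc i n) ⟩
    reverse (x i ∷ block x (suc i) n)   ≡⟨ reverse-∷ (x i) (block x (suc i) n) ⟩
    reverse (block x (suc i) n) ∷ʳ x i  ∎)
    where open ≡-Reasoning

  mirrored-dropsʳ : ∀ {p i n} d → Mirrored p i (d + n) → Mirrored p (i + d) n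
  mirrored-dropsʳ {p} {i} {n} zero mirrored =
    subst (λ j → Mirrored p j n) (sym (+-identityʳ i)) mirrored
  mirrored-dropsʳ {p} {i} {n} (suc d) mirrored =
    subst (λ j → Mirrored p j n) (sym (+-suc i d)) (mirrored-dropsʳ d (mirrored-dropʳ (d + n) mirrored))

  mirrored-infix : ∀ {p i n} d e → Mirrored p i (d + n + e) → Mirrored (p + e) (i + d) n
  mirrored-infix {p} {i} {n} d e mirrored =
    mirrored-dropsʳ d (mirrored-sym (mirrored-dropsʳ e (mirrored-sym
      (subst (Mirrored p i) (+-comm (d + n) e) mirrored))))

  reversed-infix-factor : ∀ {i n} d e →
    Factor x (reverse (block x i (d + n + e))) → Factor x (reverse (block x (i + d) n))
  reversed-infix-factor d e (p , mirrored) = p + e , mirrored-infix d e mirrored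

  occurs-in-window : ∀ {n i m N} {w : Word k n} → OccursIn x w i m → m ≤ N →
    ∃₂ λ d e → d + n + e ≡ N × block x (i + d) n ≡ w
  occurs-in-window {n} {i} {m} {N} (j , i≤j , j+n≤i+m , occ) m≤N
    with d , refl ← m≤n⇒∃[o]m+o≡n i≤j
    with e , i+d+n+e≡i+N ← m≤n⇒∃[o]m+o≡n (≤-trans j+n≤i+m (+-monoʳ-≤ i m≤N)) =
    d , e , +-cancelˡ-≡ i _ _ (trans reassoc i+d+n+e≡i+N) , occ
    where
    reassoc : i + (d + n + e) ≡ i + d + n + e
    reassoc = sym (trans (cong (_+ e) (+-assoc i d n)) (+-assoc i (d + n) e))

  long-factors-unreflected : ∀ {n m N} {w : Word k n} → ¬ Factor x (reverse w) →
    (∀ i → OccursIn x w i m) → m ≤ N → {u : Word k N} → Factor x u → ¬ Factor x (reverse u)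
  long-factors-unreflected wᴿ∉x occurs m≤N (i , refl) uᴿ∈x
    with d , e , refl , refl ← occurs-in-window (occurs i) m≤N =
    wᴿ∉x (reversed-infix-factor d e uᴿ∈x)

Unreflected : ∀ {k n} → Seq k → Word k n → Set
Unreflected x w = Factor x w × ¬ Factor x (reverse w)

module _ (em : ExcludedMiddle 0ℓ) {k : ℕ} (x : Seq k) where

  no-unreflected-factor⇒reversal-closed : ¬ (∃ λ n → ∃ λ (w : Word k n) → Unreflected x w) → ReversalClosed x
  no-unreflected-factor⇒reversal-closed ∄unreflected w w∈x with em {Factor x (reverse w)}
  ... | yes wᴿ∈x = wᴿ∈x
  ... | no  wᴿ∉x = contradiction (_ , w , w∈x , wᴿ∉x) ∄unreflected

  module _ (closed : ReversalClosed x) (n : ℕ) where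

    ρ≡Refl : ρ em x n ≡ Refl em x n
    ρ≡Refl = count-cong em n ((λ {w} w∈x → w∈x , closed w w∈x) , proj₁)

    Low High : Pred (Word k n) 0ℓ
    Low  w = Factor x w × w ≼ reverse w
    High w = Factor x w × reverse w ≼ w

    r≡count-Low : r em x n ≡ count em n Low
    r≡count-Low = count-cong em n (to , λ {w} (w∈x , w≼wᴿ) → w , w∈x , canon-fixed w w≼wᴿ)
      where
      to : ∀ {v} → (∃ λ w → Factor x w × canon w ≡ v) → Low v
      to (w , w∈x , refl) with canon-cases w
      ... | inj₁ c≡w  = subst (Factor x) (sym c≡w) w∈x , canon-≼ w
      ... | inj₂ c≡wᴿ = subst (Factor x) (sym c≡wᴿ) (closed w w∈x) , canon-≼ w

    count-Low≡count-High : count em n Low ≡ count em n High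
    count-Low≡count-High = count-bij em n n reverse
      (λ {u} (u∈x , u≼uᴿ) → closed u u∈x , subst (_≼ reverse u) (sym (reverse-involutive u)) u≼uᴿ)
      (λ _ _ → reverse-injective)
      (λ {v} (v∈x , vᴿ≼v) → reverse v
        , (closed v v∈x , subst (reverse v ≼_) (sym (reverse-involutive v)) vᴿ≼v)
        , reverse-involutive v)

    count-Low∪High≡ρ : count em n (Low ∪ High) ≡ ρ em x n
    count-Low∪High≡ρ = count-cong em n ([ proj₁ , proj₁ ] , split)
      where
      split : ∀ {w} → Factor x w → (Low ∪ High) w
      split {w} w∈x = Sum.map (w∈x ,_) (w∈x ,_) (≼-total w (reverse w))

    count-Low∩High≡Pal : count em n (Low ∩ High) ≡ Pal em x n
    count-Low∩High≡Pal = count-cong em n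
      ( (λ {w} ((w∈x , w≼wᴿ) , (_ , wᴿ≼w)) → w∈x , ≼-antisym (reverse w) w wᴿ≼w w≼wᴿ)
      , (λ {w} (w∈x , palindrome) → (w∈x , subst (w ≼_) (sym palindrome) (≼-refl w))
                                  , (w∈x , subst (_≼ w) (sym palindrome) (≼-refl w))))

    2r≡ρ+Pal : 2 * r em x n ≡ ρ em x n + Pal em x n
    2r≡ρ+Pal = begin
      r em x n + (r em x n + 0)
        ≡⟨ cong (r em x n +_) (+-identityʳ _) ⟩
      r em x n + r em x n
        ≡⟨ cong₂ _+_ r≡count-Low (trans r≡count-Low count-Low≡count-High) ⟩
      count em n Low + count em n High
        ≡⟨ count-∪-∩ em Low High ⟩
      count em n (Low ∪ High) + count em n (Low ∩ High)
        ≡⟨ cong₂ _+_ count-Low∪High≡ρ count-Low∩High≡Pal ⟩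
      ρ em x n + Pal em x n
        ∎
      where open ≡-Reasoning

  module _ {n : ℕ} (unreflected : ∀ {u : Word k n} → Factor x u → ¬ Factor x (reverse u)) where

    ρ≡Unr : ρ em x n ≡ Unr em x n
    ρ≡Unr = count-cong em n ((λ u∈x → u∈x , unreflected u∈x) , proj₁)

    r≡ρ : r em x n ≡ ρ em x n
    r≡ρ = sym (count-bij em n n canon (λ {u} u∈x → u , u∈x , refl) canon-injective id)
      where
      canon-injective : ∀ {u v} → Factor x u → Factor x v → canon u ≡ canon v → u ≡ v
      canon-injective {u} {v} u∈x v∈x cu≡cv with canon-cases u | canon-cases v
      ... | inj₁ cu≡u  | inj₁ cv≡v  = trans (sym cu≡u) (trans cu≡cv cv≡v)
      ... | inj₂ cu≡uᴿ | inj₂ cv≡vᴿ = reverse-injective (trans (sym cu≡uᴿ) (trans cu≡cv cv≡vᴿ))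
      ... | inj₁ cu≡u  | inj₂ cv≡vᴿ =
        contradiction (subst (Factor x) (trans (sym cu≡u) (trans cu≡cv cv≡vᴿ)) u∈x) (unreflected v∈x)
      ... | inj₂ cu≡uᴿ | inj₁ cv≡v  =
        contradiction (subst (Factor x) (trans (sym cv≡v) (trans (sym cu≡cv) cu≡uᴿ)) v∈x) (unreflected u∈x)

theorem3p5 : (em : ExcludedMiddle 0ℓ) → ∀ {k} (x : Seq k) → UniformlyRecurrent x →
    (ReversalClosed x
      × (∀ n → ρ em x n ≡ Refl em x n)
      × (∀ n → 2 * r em x n ≡ ρ em x n + Pal em x n))
  ⊎ (∃ λ n₀ → ∀ n → n ≥ n₀ → (ρ em x n ≡ Unr em x n) × (r em x n ≡ ρ em x n))
theorem3p5 em {k} x recurrent with em {∃ λ n → ∃ λ (w : Word k n) → Unreflected x w}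
... | no ∄unreflected =
  let closed = no-unreflected-factor⇒reversal-closed em x ∄unreflected
  in inj₁ (closed , ρ≡Refl em x closed , 2r≡ρ+Pal em x closed)
... | yes (_ , w , w∈x , wᴿ∉x) with m , occurs ← recurrent w w∈x =
  inj₂ (m , λ n m≤n → let unreflected = long-factors-unreflected x wᴿ∉x occurs m≤n
                      in ρ≡Unr em x unreflected , r≡ρ em x unreflected)
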